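{- Let $\mathbf B$ be an integral residuated lattice and $F$ a congruence filter compatible with $\mathbf B$. Then $(\mathbf B',\sigma_F,\gamma_F)$ is a lower-compatible triple, where $\mathbf B'$ is the partial algebra on $B'=(B\setminus F)\cup\{1\}$ with the operations inherited from $\mathbf B$, except that joins $x\vee y$ lying in $F\setminus\{1\}$ are redefined to be $1$, and divisions $x\backslash y$, $y/x$ whose value in $\mathbf B$ lies in $F\setminus\{1\}$ are undefined.
   Context: An IRL is a residuated lattice (lattice + monoid with $xy\le z\iff y\le x\backslash z\iff x\le z/y$) with $1$ as top. A congruence filter of an IRL is a nonempty upset closed under products and conjugates ($yx/y$, $y\backslash xy$); $[x]_F$ is the class of $x$ under $\theta_F=\{(x,y):x\backslash y,y\backslash x\in F\}$. $F$ is compatible with $\mathbf B$ if every element of $F$ is strictly above every element of $B\setminus F$; every class $[b]_F$, $b\in B\setminus F$, has a minimum $\sigma_F(b)$ and a maximum $\gamma_F(b)$ ($\sigma_F(1)=\gamma_F(1)=1$); and $b\,\sigma_F[B\setminus F]\subseteq\sigma_F[B\setminus F]\supseteq\sigma_F[B\setminus F]\,b$ for all $b\in B\setminus F$. A partial IRL is a partially ordered partial algebra in the language of residuated lattices such that: $x\le 1$ for all $x$; $x\vee y$ ($x\wedge y$) is the least upper (greatest lower) bound whenever defined; $x1=1x=x$, and $(xy)z=x(yz)$ whenever all these products are defined; if $xy$, $z/y$, $x\backslash z$ are defined then $xy\le z\iff x\le z/y\iff y\le x\backslash z$; multiplication is order preserving when defined; divisions, when defined, are order preserving in the numerator and order reversing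 in the denominator. A lower-compatible triple $(\mathbf K,\sigma,\gamma)$ consists of a partial IRL $\mathbf K$ with all operations defined except that $x\backslash y$ and $y/x$ are undefined exactly when $\sigma(x)\le y$ and $x\not\le y$, and maps $\sigma,\gamma$ on $K$ with $\sigma(x)\le y\iff x\le\gamma(y)$, such that $\sigma$ is an interior operator with $\sigma(1)=1$ and $x\sigma(y)=\sigma(xy)=\sigma(x)y$ for $x,y\ne1$, $\gamma$ is a closure operator, and $xy,\,yx\le\sigma(x)$ for all $x,y\in K$ with $y\ne 1$. -}

module Defs where

open import Level using (Level; suc; _⊔_)
open import Data.Product using (Σ; ∃; ∃-syntax; _×_; _,_; proj₁; proj₂)
open import Data.Sum using (_⊎_; inj₁; inj₂)
open import Relation.Nullary using (¬_; Dec; yes; no)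
open import Relation.Unary using (Pred)
open import Relation.Binary using (Rel)
open import Relation.Binary.PropositionalEquality using (_≡_; _≢_; refl)
open import Function.Bundles using (_⇔_)
open import Axiom.ExcludedMiddle using (ExcludedMiddle)

-- Integral residuated lattices (order-theoretic presentation, with
-- propositional equality on the carrier).
--   x \\ z  is the left residual  x\z ,  z // y  is the right residual z/y.

record IRL (ℓ : Level) : Set (suc ℓ) where
  infixl 7 _·_
  infixr 6 _∧_
  infixr 5 _∨_
  infix  4 _≤_
  field
    Carrier : Set ℓ
    _≤_     : Rel Carrier ℓ
    _∧_ _∨_ _·_ _\\_ _//_ : Carrier → Carrier → Carrier
    one     : Carrier
    ≤-refl    : ∀ {x} → x ≤ x
    ≤-trans   : ∀ {x y z} → x ≤ y → y ≤ z → x ≤ z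
    ≤-antisym : ∀ {x y} → x ≤ y → y ≤ x → x ≡ y
    ∧-lb₁ : ∀ x y → x ∧ y ≤ x
    ∧-lb₂ : ∀ x y → x ∧ y ≤ y
    ∧-glb : ∀ {x y z} → z ≤ x → z ≤ y → z ≤ x ∧ y
    ∨-ub₁ : ∀ x y → x ≤ x ∨ y
    ∨-ub₂ : ∀ x y → y ≤ x ∨ y
    ∨-lub : ∀ {x y z} → x ≤ z → y ≤ z → x ∨ y ≤ z
    ·-assoc : ∀ x y z → (x · y) · z ≡ x · (y · z)
    ·-idˡ   : ∀ x → one · x ≡ x
    ·-idʳ   : ∀ x → x · one ≡ x
    res-\\ : ∀ x y z → (x · y ≤ z) ⇔ (y ≤ x \\ z)
    res-// : ∀ x y z → (x · y ≤ z) ⇔ (x ≤ z // y)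
    one-top : ∀ x → x ≤ one

module _ {ℓ} (B : IRL ℓ) where
  open IRL B

  _<_ : Rel Carrier ℓ
  x < y = x ≤ y × x ≢ y

  record IsCongruenceFilter (F : Pred Carrier ℓ) : Set ℓ where
    field
      nonempty : ∃[ x ] F x
      upset    : ∀ {x y} → F x → x ≤ y → F y
      ·-closed : ∀ {x y} → F x → F y → F (x · y)
      conjˡ    : ∀ {x} y → F x → F ((y · x) // y)
      conjʳ    : ∀ {x} y → F x → F (y \\ (x · y))

  θ : Pred Carrier ℓ → Rel Carrier ℓ
  θ F x y = F (x \\ y) × F (y \\ x)

  record IsCompatible (F : Pred Carrier ℓ) : Set ℓ where
    field
      above  : ∀ {a b} → F a → ¬ F b → b < a
      hasMin : ∀ b → ¬ F b →
               Σ Carrier λ m → θ F b m × (∀ c → θ F b c → m ≤ c)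
      hasMax : ∀ b → ¬ F b →
               Σ Carrier λ m → θ F b m × (∀ c → θ F b c → c ≤ m)
    σ₀ : ∀ b → ¬ F b → Carrier
    σ₀ b nb = proj₁ (hasMin b nb)
    field
      ·σ-closedˡ : ∀ b → ¬ F b → ∀ c (nc : ¬ F c) →
                   Σ Carrier λ d → Σ (¬ F d) λ nd → b · σ₀ c nc ≡ σ₀ d nd
      ·σ-closedʳ : ∀ b → ¬ F b → ∀ c (nc : ¬ F c) →
                   Σ Carrier λ d → Σ (¬ F d) λ nd → σ₀ c nc · b ≡ σ₀ d nd

  -- The maps σ_F, γ_F (with σ_F(1) = γ_F(1) = 1).  Defining them as total
  -- functions needs a case split on membership in F, hence excluded middle.
  σF : ExcludedMiddle ℓ → (F : Pred Carrier ℓ) → IsCompatible F → Carrier → Carrier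
  σF lem F c b with lem {F b}
  ... | yes _  = one
  ... | no nb = proj₁ (IsCompatible.hasMin c b nb)

  γF : ExcludedMiddle ℓ → (F : Pred Carrier ℓ) → IsCompatible F → Carrier → Carrier
  γF lem F c b with lem {F b}
  ... | yes _  = one
  ... | no nb = proj₁ (IsCompatible.hasMax c b nb)

-- The carrier K is a subset (predicate Dom) of an ambient type A; the
-- partial operations are given by their graphs:
--   Meet x y z  means  "x ∧ y is defined and equals z",   etc.,
--   Ldiv x y z  means  "x \ y is defined and equals z",
--   Rdiv y x z  means  "y / x is defined and equals z".

record PartialRLStructure {a} (A : Set a) (ℓ : Level) : Set (a ⊔ suc ℓ) where
  field
    Dom  : Pred A ℓ
    _≤_  : Rel A ℓ
    one  : A
    Meet Join Mul Ldiv Rdiv : A → A → A → Set ℓ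

module _ {a ℓ} {A : Set a} (K : PartialRLStructure A ℓ) where
  open PartialRLStructure K

  record IsPartialOp (R : A → A → A → Set ℓ) : Set (a ⊔ ℓ) where
    field
      closed     : ∀ {x y z} → Dom x → Dom y → R x y z → Dom z
      functional : ∀ {x y z z'} → Dom x → Dom y → R x y z → R x y z' → z ≡ z'

  record IsPartialIRL : Set (a ⊔ ℓ) where
    field
      isMeet : IsPartialOp Meet
      isJoin : IsPartialOp Join
      isMul  : IsPartialOp Mul
      isLdiv : IsPartialOp Ldiv
      isRdiv : IsPartialOp Rdiv
      ≤-refl    : ∀ {x} → Dom x → x ≤ x
      ≤-trans   : ∀ {x y z} → Dom x → Dom y → Dom z → x ≤ y → y ≤ z → x ≤ z
      ≤-antisym : ∀ {x y} → Dom x → Dom y → x ≤ y → y ≤ x → x ≡ y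
      one-dom : Dom one
      one-top : ∀ {x} → Dom x → x ≤ one
      join-lub : ∀ {x y z} → Dom x → Dom y → Join x y z →
                 x ≤ z × y ≤ z × (∀ {w} → Dom w → x ≤ w → y ≤ w → z ≤ w)
      meet-glb : ∀ {x y z} → Dom x → Dom y → Meet x y z →
                 z ≤ x × z ≤ y × (∀ {w} → Dom w → w ≤ x → w ≤ y → w ≤ z)
      mul-idʳ : ∀ {x} → Dom x → Mul x one x
      mul-idˡ : ∀ {x} → Dom x → Mul one x x
      mul-assoc : ∀ {x y z u v w t} → Dom x → Dom y → Dom z →
                  Mul x y u → Mul u z v → Mul y z w → Mul x w t → v ≡ t
      residuation : ∀ {x y z u r l} → Dom x → Dom y → Dom z →
                    Mul x y u → Rdiv z y r → Ldiv x z l →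
                    ((u ≤ z) ⇔ (x ≤ r)) × ((x ≤ r) ⇔ (y ≤ l))
      mul-monoˡ : ∀ {x x' y u u'} → Dom x → Dom x' → Dom y →
                  Mul x y u → Mul x' y u' → x ≤ x' → u ≤ u'
      mul-monoʳ : ∀ {x y y' u u'} → Dom x → Dom y → Dom y' →
                  Mul x y u → Mul x y' u' → y ≤ y' → u ≤ u'
      ldiv-num : ∀ {x y y' l l'} → Dom x → Dom y → Dom y' →
                 Ldiv x y l → Ldiv x y' l' → y ≤ y' → l ≤ l'
      ldiv-den : ∀ {x x' y l l'} → Dom x → Dom x' → Dom y →
                 Ldiv x y l → Ldiv x' y l' → x ≤ x' → l' ≤ l
      rdiv-num : ∀ {y y' x r r'} → Dom y → Dom y' → Dom x →
                 Rdiv y x r → Rdiv y' x r' → y ≤ y' → r ≤ r'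
      rdiv-den : ∀ {y x x' r r'} → Dom y → Dom x → Dom x' →
                 Rdiv y x r → Rdiv y x' r' → x ≤ x' → r' ≤ r

  record IsLowerCompatibleTriple (σ γ : A → A) : Set (a ⊔ ℓ) where
    field
      isPartialIRL : IsPartialIRL
      meet-total : ∀ {x y} → Dom x → Dom y → ∃[ z ] Meet x y z
      join-total : ∀ {x y} → Dom x → Dom y → ∃[ z ] Join x y z
      mul-total  : ∀ {x y} → Dom x → Dom y → ∃[ z ] Mul x y z
      ldiv-undef : ∀ {x y} → Dom x → Dom y →
                   (¬ (∃[ z ] Ldiv x y z)) ⇔ (σ x ≤ y × ¬ (x ≤ y))
      rdiv-undef : ∀ {x y} → Dom x → Dom y →
                   (¬ (∃[ z ] Rdiv y x z)) ⇔ (σ x ≤ y × ¬ (x ≤ y))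
      σ-dom : ∀ {x} → Dom x → Dom (σ x)
      γ-dom : ∀ {x} → Dom x → Dom (γ x)
      galois : ∀ {x y} → Dom x → Dom y → (σ x ≤ y) ⇔ (x ≤ γ y)
      σ-deflationary : ∀ {x} → Dom x → σ x ≤ x
      σ-mono         : ∀ {x y} → Dom x → Dom y → x ≤ y → σ x ≤ σ y
      σ-idem         : ∀ {x} → Dom x → σ (σ x) ≡ σ x
      σ-one          : σ one ≡ one
      σ-mul : ∀ {x y u v w} → Dom x → Dom y → x ≢ one → y ≢ one →
              Mul x (σ y) u → Mul x y v → Mul (σ x) y w →
              u ≡ σ v × σ v ≡ w
      γ-inflationary : ∀ {x} → Dom x → x ≤ γ x
      γ-mono         : ∀ {x y} → Dom x → Dom y → x ≤ y → γ x ≤ γ y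
      γ-idem         : ∀ {x} → Dom x → γ (γ x) ≡ γ x
      mul-below-σˡ : ∀ {x y u} → Dom x → Dom y → y ≢ one → Mul x y u → u ≤ σ x
      mul-below-σʳ : ∀ {x y u} → Dom x → Dom y → y ≢ one → Mul y x u → u ≤ σ x

module _ {ℓ} (B : IRL ℓ) where
  open IRL B

  B' : Pred Carrier ℓ → PartialRLStructure Carrier ℓ
  B' F = record
    { Dom  = InB'
    ; _≤_  = _≤_
    ; one  = one
    ; Meet = λ x y z → z ≡ x ∧ y
    ; Mul  = λ x y z → z ≡ x · y
    ; Join = λ x y z → (InB' (x ∨ y) × z ≡ x ∨ y)
                     ⊎ (F (x ∨ y) × x ∨ y ≢ one × z ≡ one)
    ; Ldiv = λ x y z → InB' (x \\ y) × z ≡ x \\ y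
    ; Rdiv = λ y x z → InB' (y // x) × z ≡ y // x
    }
    where
    InB' : Pred Carrier ℓ
    InB' x = ¬ F x ⊎ x ≡ one

{-# OPTIONS --safe #-}
-- For x ∉ F, σ_F(x) ≤ z holds exactly when x\z ∈ F, because x ∧ z lies in the class of x;
-- dually z ≤ γ_F(y) exactly when z\y ∈ F, because z ∨ y lies in the class of y.  Both
-- characterisations survive the adjunction of 1, and every axiom of a lower-compatible triple
-- then becomes a statement about the filter F.  For the product law, x σ_F(y) is a σ_F-image
-- by compatibility, hence fixed by σ_F, and it is θ_F-related to xy.
module Submission where

open import Defs
open import Axiom.ExcludedMiddle using (ExcludedMiddle)
open import Relation.Unary using (Pred)
open import Data.Product using (∃-syntax; _×_; _,_; proj₁; proj₂; swap)
open import Data.Product.Function.NonDependent.Propositional using (_×-⇔_)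
open import Data.Sum using (_⊎_; inj₁; inj₂)
open import Data.Empty using (⊥-elim)
open import Relation.Nullary using (¬_; yes; no)
open import Relation.Nullary.Decidable using (decidable-stable)
open import Relation.Binary.PropositionalEquality
  using (_≡_; _≢_; refl; sym; trans; cong; subst; module ≡-Reasoning)
open import Function.Bundles using (_⇔_; mk⇔; Equivalence)
open import Function.Properties.Equivalence using () renaming (sym to ⇔-sym; trans to ⇔-trans)
open import Function.Related.TypeIsomorphisms using (¬-cong-⇔)

open Equivalence using (to; from)

¬∃-graph⇔¬ : ∀ {a p} {A : Set a} {P : Set p} {f : A} → (¬ (∃[ z ] (P × z ≡ f))) ⇔ (¬ P)
¬∃-graph⇔¬ = mk⇔ (λ h p → h (_ , p , refl)) (λ n h → n (proj₁ (proj₂ h)))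

module IRLProperties {ℓ} (B : IRL ℓ) where
  open IRL B

  private variable a b x x′ y y′ z : Carrier

  ≡⇒≤ : x ≡ y → x ≤ y
  ≡⇒≤ refl = ≤-refl

  ·≤⇒≤\\ : x · y ≤ z → y ≤ x \\ z
  ·≤⇒≤\\ = to (res-\\ _ _ _)

  ≤\\⇒·≤ : y ≤ x \\ z → x · y ≤ z
  ≤\\⇒·≤ = from (res-\\ _ _ _)

  ·≤⇒≤// : x · y ≤ z → x ≤ z // y
  ·≤⇒≤// = to (res-// _ _ _)

  ≤//⇒·≤ : x ≤ z // y → x · y ≤ z
  ≤//⇒·≤ = from (res-// _ _ _)

  ≤//⇔≤\\ : (x ≤ z // y) ⇔ (y ≤ x \\ z)
  ≤//⇔≤\\ = ⇔-trans (⇔-sym (res-// _ _ _)) (res-\\ _ _ _)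

  x·[x\\y]≤y : x · (x \\ y) ≤ y
  x·[x\\y]≤y = ≤\\⇒·≤ ≤-refl

  [y//x]·x≤y : (y // x) · x ≤ y
  [y//x]·x≤y = ≤//⇒·≤ ≤-refl

  ·-monoʳ-≤ : y ≤ y′ → x · y ≤ x · y′
  ·-monoʳ-≤ y≤y′ = ≤\\⇒·≤ (≤-trans y≤y′ (·≤⇒≤\\ ≤-refl))

  ·-monoˡ-≤ : x ≤ x′ → x · y ≤ x′ · y
  ·-monoˡ-≤ x≤x′ = ≤//⇒·≤ (≤-trans x≤x′ (·≤⇒≤// ≤-refl))

  x·y≤x : ∀ x y → x · y ≤ x
  x·y≤x x y = ≤-trans (·-monoʳ-≤ (one-top y)) (≡⇒≤ (·-idʳ x))

  x·y≤y : ∀ x y → x · y ≤ y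
  x·y≤y x y = ≤-trans (·-monoˡ-≤ (one-top x)) (≡⇒≤ (·-idˡ y))

  \\-monoʳ-≤ : y ≤ y′ → x \\ y ≤ x \\ y′
  \\-monoʳ-≤ y≤y′ = ·≤⇒≤\\ (≤-trans x·[x\\y]≤y y≤y′)

  \\-antimonoˡ-≤ : x ≤ x′ → x′ \\ y ≤ x \\ y
  \\-antimonoˡ-≤ x≤x′ = ·≤⇒≤\\ (≤-trans (·-monoˡ-≤ x≤x′) x·[x\\y]≤y)

  //-monoˡ-≤ : y ≤ y′ → y // x ≤ y′ // x
  //-monoˡ-≤ y≤y′ = ·≤⇒≤// (≤-trans [y//x]·x≤y y≤y′)

  //-antimonoʳ-≤ : x ≤ x′ → y // x′ ≤ y // x
  //-antimonoʳ-≤ x≤x′ = ·≤⇒≤// (≤-trans (·-monoʳ-≤ x≤x′) [y//x]·x≤y)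

  ≤⇒one≤\\ : x ≤ y → one ≤ x \\ y
  ≤⇒one≤\\ {x} x≤y = ·≤⇒≤\\ (≤-trans (≡⇒≤ (·-idʳ x)) x≤y)

  \\≡one⇔≤ : (x \\ y ≡ one) ⇔ (x ≤ y)
  \\≡one⇔≤ {x} = mk⇔
    (λ e → ≤-trans (≡⇒≤ (sym (·-idʳ x))) (≤\\⇒·≤ (≡⇒≤ (sym e))))
    (λ x≤y → ≤-antisym (one-top _) (≤⇒one≤\\ x≤y))

  //≡one⇔≤ : (y // x ≡ one) ⇔ (x ≤ y)
  //≡one⇔≤ {x = x} = mk⇔
    (λ e → ≤-trans (≡⇒≤ (sym (·-idˡ x))) (≤//⇒·≤ (≡⇒≤ (sym e))))
    (λ x≤y → ≤-antisym (one-top _) (·≤⇒≤// (≤-trans (≡⇒≤ (·-idˡ x)) x≤y)))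

  \\-compose : (x \\ y) · (y \\ z) ≤ x \\ z
  \\-compose {x} {y} {z} = ·≤⇒≤\\
    (≤-trans (≡⇒≤ (sym (·-assoc x (x \\ y) (y \\ z)))) (≤-trans (·-monoˡ-≤ x·[x\\y]≤y) x·[x\\y]≤y))

  \\-∧ : x \\ z ≤ x \\ (x ∧ z)
  \\-∧ {x} {z} = ·≤⇒≤\\ (∧-glb (x·y≤x x (x \\ z)) x·[x\\y]≤y)

  \\-∨ : z \\ y ≤ (z ∨ y) \\ y
  \\-∨ {z} {y} = ·≤⇒≤\\ (≤//⇒·≤ (∨-lub (·≤⇒≤// x·[x\\y]≤y) (·≤⇒≤// (x·y≤x y (z \\ y)))))

  \\-·ˡ : a \\ b ≤ (x · a) \\ (x · b)
  \\-·ˡ {a} {b} {x} = ·≤⇒≤\\ (≤-trans (≡⇒≤ (·-assoc x a (a \\ b))) (·-monoʳ-≤ x·[x\\y]≤y))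

  //-·ʳ : b // a ≤ (b · x) // (a · x)
  //-·ʳ {b} {a} {x} = ·≤⇒≤// (≤-trans (≡⇒≤ (sym (·-assoc (b // a) a x))) (·-monoˡ-≤ [y//x]·x≤y))

module CongruenceFilterProperties {ℓ} (B : IRL ℓ) {F : Pred (IRL.Carrier B) ℓ}
                                  (cf : IsCongruenceFilter B F) where
  open IRL B
  open IsCongruenceFilter cf
  open IRLProperties B
  open PartialRLStructure (B' B F) using (Join)

  private variable a b x y z z′ : Carrier

  F-one : F one
  F-one = upset (proj₂ nonempty) (one-top _)

  ≤⇒F\\ : x ≤ y → F (x \\ y)
  ≤⇒F\\ x≤y = upset F-one (≤⇒one≤\\ x≤y)

  F\\-trans : F (x \\ y) → F (y \\ z) → F (x \\ z)
  F\\-trans p q = upset (·-closed p q) \\-compose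

  F-mp : F a → F (a \\ b) → F b
  F-mp p q = upset (·-closed p q) x·[x\\y]≤y

  ¬F-≤ : ¬ F b → a ≤ b → ¬ F a
  ¬F-≤ ¬Fb a≤b Fa = ¬Fb (upset Fa a≤b)

  F\\⇔F// : F (x \\ y) ⇔ F (y // x)
  F\\⇔F// {x} = mk⇔ (λ p → upset (conjˡ x p) (//-monoˡ-≤ x·[x\\y]≤y))
                    (λ p → upset (conjʳ x p) (\\-monoʳ-≤ [y//x]·x≤y))

  θ-·ˡ : θ B F a b → θ B F (x · a) (x · b)
  θ-·ˡ (p , q) = upset p \\-·ˡ , upset q \\-·ˡ

  θ-·ʳ : θ B F a b → θ B F (a · x) (b · x)
  θ-·ʳ (p , q) = ·ʳ p , ·ʳ q
    where
    ·ʳ : F (a \\ b) → F ((a · x) \\ (b · x))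
    ·ʳ p = from F\\⇔F// (upset (to F\\⇔F// p) //-·ʳ)

  InB' : Pred Carrier ℓ
  InB' x = ¬ F x ⊎ x ≡ one

  InB'-F⇒≡one : InB' x → F x → x ≡ one
  InB'-F⇒≡one (inj₁ ¬Fx) Fx = ⊥-elim (¬Fx Fx)
  InB'-F⇒≡one (inj₂ x≡one) _ = x≡one

  InB'-≢one⇒¬F : InB' x → x ≢ one → ¬ F x
  InB'-≢one⇒¬F dx x≢one Fx = x≢one (InB'-F⇒≡one dx Fx)

  InB'-∧ : InB' x → InB' y → InB' (x ∧ y)
  InB'-∧ {x} {y} (inj₁ ¬Fx) _ = inj₁ (¬F-≤ ¬Fx (∧-lb₁ x y))
  InB'-∧ {x} {y} (inj₂ refl) (inj₁ ¬Fy) = inj₁ (¬F-≤ ¬Fy (∧-lb₂ x y))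
  InB'-∧ (inj₂ refl) (inj₂ refl) = inj₂ (≤-antisym (one-top _) (∧-glb ≤-refl ≤-refl))

  InB'-· : InB' x → InB' y → InB' (x · y)
  InB'-· {x} {y} (inj₁ ¬Fx) _ = inj₁ (¬F-≤ ¬Fx (x·y≤x x y))
  InB'-· {x} {y} (inj₂ refl) (inj₁ ¬Fy) = inj₁ (¬F-≤ ¬Fy (x·y≤y x y))
  InB'-· (inj₂ refl) (inj₂ refl) = inj₂ (·-idˡ one)

  join-functional : Join x y z → Join x y z′ → z ≡ z′
  join-functional (inj₁ (_ , p)) (inj₁ (_ , q)) = trans p (sym q)
  join-functional (inj₂ (_ , _ , p)) (inj₂ (_ , _ , q)) = trans p (sym q)
  join-functional (inj₁ (inj₁ ¬F∨ , _)) (inj₂ (F∨ , _)) = ⊥-elim (¬F∨ F∨)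
  join-functional (inj₁ (inj₂ ∨≡one , _)) (inj₂ (_ , ∨≢one , _)) = ⊥-elim (∨≢one ∨≡one)
  join-functional (inj₂ (F∨ , _)) (inj₁ (inj₁ ¬F∨ , _)) = ⊥-elim (¬F∨ F∨)
  join-functional (inj₂ (_ , ∨≢one , _)) (inj₁ (inj₂ ∨≡one , _)) = ⊥-elim (∨≢one ∨≡one)

  join-lub : Join x y z → x ≤ z × y ≤ z × (∀ {w} → InB' w → x ≤ w → y ≤ w → z ≤ w)
  join-lub {x} {y} (inj₁ (_ , refl)) = ∨-ub₁ x y , ∨-ub₂ x y , λ _ → ∨-lub
  join-lub {x} {y} (inj₂ (F∨ , _ , refl)) = one-top x , one-top y ,
    λ dw x≤w y≤w → ≡⇒≤ (sym (InB'-F⇒≡one dw (upset F∨ (∨-lub x≤w y≤w))))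

  B'-isPartialIRL : IsPartialIRL (B' B F)
  B'-isPartialIRL = record
    { isMeet = record { closed = λ { dx dy refl → InB'-∧ dx dy }
                      ; functional = λ _ _ p q → trans p (sym q) }
    ; isJoin = record { closed = λ { _ _ (inj₁ (d , refl)) → d ; _ _ (inj₂ (_ , _ , refl)) → inj₂ refl }
                      ; functional = λ _ _ → join-functional }
    ; isMul = record { closed = λ { dx dy refl → InB'-· dx dy }
                     ; functional = λ _ _ p q → trans p (sym q) }
    ; isLdiv = record { closed = λ { _ _ (d , refl) → d }
                      ; functional = λ _ _ p q → trans (proj₂ p) (sym (proj₂ q)) }
    ; isRdiv = record { closed = λ { _ _ (d , refl) → d }
                      ; functional = λ _ _ p q → trans (proj₂ p) (sym (proj₂ q)) }
    ; ≤-refl = λ _ → ≤-refl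
    ; ≤-trans = λ _ _ _ → ≤-trans
    ; ≤-antisym = λ _ _ → ≤-antisym
    ; one-dom = inj₂ refl
    ; one-top = λ _ → one-top _
    ; join-lub = λ _ _ → join-lub
    ; meet-glb = λ { {x} {y} _ _ refl → ∧-lb₁ x y , ∧-lb₂ x y , λ _ → ∧-glb }
    ; mul-idʳ = λ _ → sym (·-idʳ _)
    ; mul-idˡ = λ _ → sym (·-idˡ _)
    ; mul-assoc = λ { {x} {y} {z} _ _ _ refl refl refl refl → ·-assoc x y z }
    ; residuation = λ { {x} {y} {z} _ _ _ refl (_ , refl) (_ , refl) → res-// x y z , ≤//⇔≤\\ }
    ; mul-monoˡ = λ { _ _ _ refl refl → ·-monoˡ-≤ }
    ; mul-monoʳ = λ { _ _ _ refl refl → ·-monoʳ-≤ }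
    ; ldiv-num = λ { _ _ _ (_ , refl) (_ , refl) → \\-monoʳ-≤ }
    ; ldiv-den = λ { _ _ _ (_ , refl) (_ , refl) → \\-antimonoˡ-≤ }
    ; rdiv-num = λ { _ _ _ (_ , refl) (_ , refl) → //-monoˡ-≤ }
    ; rdiv-den = λ { _ _ _ (_ , refl) (_ , refl) → //-antimonoʳ-≤ }
    }

module CompatibleFilterProperties {ℓ} (lem : ExcludedMiddle ℓ) (B : IRL ℓ)
                                  {F : Pred (IRL.Carrier B) ℓ} (cf : IsCongruenceFilter B F)
                                  (comp : IsCompatible B F) where
  open IRL B
  open IsCongruenceFilter cf
  open IsCompatible comp
  open IRLProperties B
  open CongruenceFilterProperties B cf
  open PartialRLStructure (B' B F) using (Join)
  open ≡-Reasoning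

  private variable a b x y z : Carrier

  σ : Carrier → Carrier
  σ = σF B lem F comp

  γ : Carrier → Carrier
  γ = γF B lem F comp

  σ-one : σ one ≡ one
  σ-one with lem {F one}
  ... | yes _ = refl
  ... | no ¬F1 = ⊥-elim (¬F1 F-one)

  γ-one : γ one ≡ one
  γ-one with lem {F one}
  ... | yes _ = refl
  ... | no ¬F1 = ⊥-elim (¬F1 F-one)

  σ-minimum : ¬ F x → θ B F x (σ x) × (∀ c → θ B F x c → σ x ≤ c)
  σ-minimum {x} ¬Fx with lem {F x}
  ... | yes Fx = ⊥-elim (¬Fx Fx)
  ... | no ¬Fx′ = proj₂ (hasMin x ¬Fx′)

  γ-maximum : ¬ F x → θ B F x (γ x) × (∀ c → θ B F x c → c ≤ γ x)
  γ-maximum {x} ¬Fx with lem {F x}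
  ... | yes Fx = ⊥-elim (¬Fx Fx)
  ... | no ¬Fx′ = proj₂ (hasMax x ¬Fx′)

  σ-θ : ¬ F x → θ B F x (σ x)
  σ-θ ¬Fx = proj₁ (σ-minimum ¬Fx)

  γ-θ : ¬ F x → θ B F x (γ x)
  γ-θ ¬Fx = proj₁ (γ-maximum ¬Fx)

  σ₀≡σ : (¬Fx : ¬ F x) → σ₀ x ¬Fx ≡ σ x
  σ₀≡σ {x} ¬Fx = ≤-antisym (proj₂ (proj₂ (hasMin x ¬Fx)) (σ x) (σ-θ ¬Fx))
                           (proj₂ (σ-minimum ¬Fx) _ (proj₁ (proj₂ (hasMin x ¬Fx))))

  σ≤⇔F\\ : ¬ F x → (σ x ≤ z) ⇔ F (x \\ z)
  σ≤⇔F\\ {x} {z} ¬Fx = mk⇔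
    (λ σx≤z → F\\-trans (proj₁ (σ-θ ¬Fx)) (≤⇒F\\ σx≤z))
    (λ p → ≤-trans (proj₂ (σ-minimum ¬Fx) (x ∧ z) (upset p \\-∧ , ≤⇒F\\ (∧-lb₁ x z))) (∧-lb₂ x z))

  ≤γ⇔F\\ : ¬ F y → (z ≤ γ y) ⇔ F (z \\ y)
  ≤γ⇔F\\ {y} {z} ¬Fy = mk⇔
    (λ z≤γy → F\\-trans (≤⇒F\\ z≤γy) (proj₂ (γ-θ ¬Fy)))
    (λ p → ≤-trans (∨-ub₁ z y) (proj₂ (γ-maximum ¬Fy) (z ∨ y) (≤⇒F\\ (∨-ub₂ z y) , upset p \\-∨)))

  σ≤⇔ : InB' x → InB' z → (σ x ≤ z) ⇔ F (x \\ z)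
  σ≤⇔ (inj₁ ¬Fx) _ = σ≤⇔F\\ ¬Fx
  σ≤⇔ (inj₂ refl) dz = mk⇔
    (λ σ1≤z → ≤⇒F\\ (≤-trans (≡⇒≤ (sym σ-one)) σ1≤z))
    (λ p → subst (σ one ≤_) (sym (InB'-F⇒≡one dz (F-mp F-one p))) (one-top _))

  ≤γ⇔ : InB' y → (z ≤ γ y) ⇔ F (z \\ y)
  ≤γ⇔ (inj₁ ¬Fy) = ≤γ⇔F\\ ¬Fy
  ≤γ⇔ (inj₂ refl) = mk⇔ (λ _ → ≤⇒F\\ (one-top _)) (λ _ → ≤-trans (one-top _) (≡⇒≤ (sym γ-one)))

  InB'-σ : InB' x → InB' (σ x)
  InB'-σ (inj₁ ¬Fx) = inj₁ (λ Fσx → ¬Fx (F-mp Fσx (proj₂ (σ-θ ¬Fx))))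
  InB'-σ (inj₂ refl) = inj₂ σ-one

  InB'-γ : InB' x → InB' (γ x)
  InB'-γ (inj₁ ¬Fx) = inj₁ (λ Fγx → ¬Fx (F-mp Fγx (proj₂ (γ-θ ¬Fx))))
  InB'-γ (inj₂ refl) = inj₂ γ-one

  F[x\\σx] : InB' x → F (x \\ σ x)
  F[x\\σx] dx = to (σ≤⇔ dx (InB'-σ dx)) ≤-refl

  F[γx\\x] : InB' x → F (γ x \\ x)
  F[γx\\x] dx = to (≤γ⇔ dx) ≤-refl

  galois : InB' x → InB' y → (σ x ≤ y) ⇔ (x ≤ γ y)
  galois dx dy = ⇔-trans (σ≤⇔ dx dy) (⇔-sym (≤γ⇔ dy))

  σ-deflationary : InB' x → σ x ≤ x
  σ-deflationary dx = from (σ≤⇔ dx dx) (≤⇒F\\ ≤-refl)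

  γ-inflationary : InB' x → x ≤ γ x
  γ-inflationary dx = from (≤γ⇔ dx) (≤⇒F\\ ≤-refl)

  σ-monoᶠ : InB' a → InB' b → F (a \\ b) → σ a ≤ σ b
  σ-monoᶠ da db p = from (σ≤⇔ da (InB'-σ db)) (F\\-trans p (F[x\\σx] db))

  γ-monoᶠ : InB' a → InB' b → F (a \\ b) → γ a ≤ γ b
  γ-monoᶠ da db p = from (≤γ⇔ db) (F\\-trans (F[γx\\x] da) p)

  σ-idem : InB' x → σ (σ x) ≡ σ x
  σ-idem dx = ≤-antisym (σ-deflationary (InB'-σ dx)) (σ-monoᶠ dx (InB'-σ dx) (F[x\\σx] dx))

  γ-idem : InB' x → γ (γ x) ≡ γ x
  γ-idem dx = ≤-antisym (γ-monoᶠ (InB'-γ dx) dx (F[γx\\x] dx)) (γ-inflationary (InB'-γ dx))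

  σ-resp-θ : InB' a → InB' b → θ B F a b → σ a ≡ σ b
  σ-resp-θ da db (p , q) = ≤-antisym (σ-monoᶠ da db p) (σ-monoᶠ db da q)

  σ-·ˡ : ¬ F x → ¬ F y → x · σ y ≡ σ (x · y)
  σ-·ˡ {x} {y} ¬Fx ¬Fy with ·σ-closedˡ x ¬Fx y ¬Fy
  ... | d , ¬Fd , x·σ₀y≡σ₀d = begin
    x · σ y        ≡⟨ image ⟩
    σ d            ≡⟨ sym (σ-idem (inj₁ ¬Fd)) ⟩
    σ (σ d)        ≡⟨ cong σ (sym image) ⟩
    σ (x · σ y)    ≡⟨ σ-resp-θ (inj₁ (¬F-≤ ¬Fx (x·y≤x x (σ y)))) (inj₁ (¬F-≤ ¬Fx (x·y≤x x y)))
                               (θ-·ˡ (swap (σ-θ ¬Fy))) ⟩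
    σ (x · y)      ∎
    where
    image : x · σ y ≡ σ d
    image = trans (cong (x ·_) (sym (σ₀≡σ ¬Fy))) (trans x·σ₀y≡σ₀d (σ₀≡σ ¬Fd))

  σ-·ʳ : ¬ F x → ¬ F y → σ (x · y) ≡ σ x · y
  σ-·ʳ {x} {y} ¬Fx ¬Fy with ·σ-closedʳ y ¬Fy x ¬Fx
  ... | d , ¬Fd , σ₀x·y≡σ₀d = begin
    σ (x · y)      ≡⟨ σ-resp-θ (inj₁ (¬F-≤ ¬Fy (x·y≤y x y))) (inj₁ (¬F-≤ ¬Fy (x·y≤y (σ x) y)))
                               (θ-·ʳ (σ-θ ¬Fx)) ⟩
    σ (σ x · y)    ≡⟨ cong σ image ⟩
    σ (σ d)        ≡⟨ σ-idem (inj₁ ¬Fd) ⟩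
    σ d            ≡⟨ sym image ⟩
    σ x · y        ∎
    where
    image : σ x · y ≡ σ d
    image = trans (cong (_· y) (sym (σ₀≡σ ¬Fx))) (trans σ₀x·y≡σ₀d (σ₀≡σ ¬Fd))

  ·≤σˡ : InB' x → ¬ F y → x · y ≤ σ x
  ·≤σˡ dx ¬Fy = ≤\\⇒·≤ (proj₁ (above (F[x\\σx] dx) ¬Fy))

  ·≤σʳ : InB' x → ¬ F y → y · x ≤ σ x
  ·≤σʳ dx ¬Fy = ≤//⇒·≤ (proj₁ (above (to F\\⇔F// (F[x\\σx] dx)) ¬Fy))

  ¬InB'⇔ : (¬ InB' a) ⇔ (F a × a ≢ one)
  ¬InB'⇔ = mk⇔ (λ h → decidable-stable lem (λ ¬Fa → h (inj₁ ¬Fa)) , λ e → h (inj₂ e))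
               (λ { (Fa , _) (inj₁ ¬Fa) → ¬Fa Fa ; (_ , a≢one) (inj₂ a≡one) → a≢one a≡one })

  \\-undefined⇔ : InB' x → InB' y → (¬ InB' (x \\ y)) ⇔ (σ x ≤ y × ¬ (x ≤ y))
  \\-undefined⇔ dx dy = ⇔-trans ¬InB'⇔ (⇔-sym (σ≤⇔ dx dy) ×-⇔ ¬-cong-⇔ \\≡one⇔≤)

  //-undefined⇔ : InB' x → InB' y → (¬ InB' (y // x)) ⇔ (σ x ≤ y × ¬ (x ≤ y))
  //-undefined⇔ dx dy =
    ⇔-trans ¬InB'⇔ (⇔-trans (⇔-sym F\\⇔F//) (⇔-sym (σ≤⇔ dx dy)) ×-⇔ ¬-cong-⇔ //≡one⇔≤)

  join-total : ∃[ z ] Join x y z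
  join-total {x} {y} with lem {InB' (x ∨ y)}
  ... | yes d = x ∨ y , inj₁ (d , refl)
  ... | no ¬d with to ¬InB'⇔ ¬d
  ...   | F∨ , ∨≢one = one , inj₂ (F∨ , ∨≢one , refl)

lemma2p5 : ∀ {ℓ} (lem : ExcludedMiddle ℓ) (B : IRL ℓ) (F : Pred (IRL.Carrier B) ℓ) →
             IsCongruenceFilter B F → (comp : IsCompatible B F) →
             IsLowerCompatibleTriple (B' B F) (σF B lem F comp) (γF B lem F comp)
lemma2p5 lem B F cf comp = record
  { isPartialIRL = B'-isPartialIRL
  ; meet-total = λ _ _ → _ , refl
  ; join-total = λ _ _ → join-total
  ; mul-total = λ _ _ → _ , refl
  ; ldiv-undef = λ dx dy → ⇔-trans ¬∃-graph⇔¬ (\\-undefined⇔ dx dy)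
  ; rdiv-undef = λ dx dy → ⇔-trans ¬∃-graph⇔¬ (//-undefined⇔ dx dy)
  ; σ-dom = InB'-σ
  ; γ-dom = InB'-γ
  ; galois = galois
  ; σ-deflationary = σ-deflationary
  ; σ-mono = λ dx dy x≤y → σ-monoᶠ dx dy (≤⇒F\\ x≤y)
  ; σ-idem = σ-idem
  ; σ-one = σ-one
  ; σ-mul = λ { dx dy x≢one y≢one refl refl refl →
      let ¬Fx = InB'-≢one⇒¬F dx x≢one ; ¬Fy = InB'-≢one⇒¬F dy y≢one in σ-·ˡ ¬Fx ¬Fy , σ-·ʳ ¬Fx ¬Fy }
  ; γ-inflationary = γ-inflationary
  ; γ-mono = λ dx dy x≤y → γ-monoᶠ dx dy (≤⇒F\\ x≤y)
  ; γ-idem = γ-idem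
  ; mul-below-σˡ = λ { dx dy y≢one refl → ·≤σˡ dx (InB'-≢one⇒¬F dy y≢one) }
  ; mul-below-σʳ = λ { dx dy y≢one refl → ·≤σʳ dx (InB'-≢one⇒¬F dy y≢one) }
  }
  where
  open CongruenceFilterProperties B cf
  open CompatibleFilterProperties lem B cf comp
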